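{- Let $N \ge 1$, let $G_N$ be the divisibility graph on $X_N=\{1,\dots,N\}$, and let $s,t \in X_N$ be distinct vertices that are not adjacent in $G_N$. Let $d(s,t)=\gcd(s,t)$ and let $\sigma_0(m)$ denote the number of positive divisors of $m$. Then the number $g_{st}$ of geodesic (shortest) paths between $s$ and $t$ in $G_N$ is $$g_{st} = \sigma_0\big(d(s,t)\big) + \left\lfloor \frac{N}{st/d(s,t)} \right\rfloor.$$
   Context: The divisibility graph $G_N$ is the simple undirected graph with vertex set $X_N=\{1,\dots,N\}$, in which two distinct vertices $i \ne j$ are adjacent if and only if $i$ divides $j$ or $j$ divides $i$ (no loops). A geodesic path between two vertices is a path of minimum length between them. $\lfloor x \rfloor$ denotes the floor of $x$. (The paper writes $s(\cdot)$ for the divisor-counting function; here it is written $\sigma_0$ to avoid a clash with the vertex name $s$.) -}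

module Defs where

open import Data.Nat using (ℕ; zero; suc; _+_; _*_; _≤_; _<_; _/_)
open import Data.Nat.Divisibility using (_∣_; _∣?_)
open import Data.Nat.GCD using (gcd)
open import Data.List using (List; []; _∷_; length; filter; upTo; map; last)
open import Data.List.Relation.Unary.All using (All)
open import Data.List.Relation.Unary.Unique.Propositional using (Unique)
open import Data.List.Membership.Propositional using (_∈_)
open import Data.Maybe using (Maybe; just)
open import Data.Product using (_×_; Σ)
open import Data.Sum using (_⊎_)
open import Relation.Binary.PropositionalEquality using (_≡_; _≢_)

InX : ℕ → ℕ → Set
InX N v = 1 ≤ v × v ≤ N

Adj : ℕ → ℕ → Set
Adj i j = i ≢ j × (i ∣ j ⊎ j ∣ i)

data Chain : List ℕ → Set where
  []  : Chain []
  [-] : ∀ {x} → Chain (x ∷ [])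
  _∷_ : ∀ {x y xs} → Adj x y → Chain (y ∷ xs) → Chain (x ∷ y ∷ xs)

record IsPath (N s t : ℕ) (p : List ℕ) : Set where
  field
    vertices : All (InX N) p
    adjacent : Chain p
    simple   : Unique p
    starts   : Σ (List ℕ) (λ rest → p ≡ s ∷ rest)
    ends     : last p ≡ just t

pathLength : List ℕ → ℕ
pathLength []       = 0
pathLength (_ ∷ xs) = length xs

IsGeodesic : ℕ → ℕ → ℕ → List ℕ → Set
IsGeodesic N s t p =
  IsPath N s t p × (∀ q → IsPath N s t q → pathLength p ≤ pathLength q)

NumGeodesics : ℕ → ℕ → ℕ → ℕ → Set
NumGeodesics N s t k =
  Σ (List (List ℕ)) λ ps →
    Unique ps × (∀ p → p ∈ ps → IsGeodesic N s t p)
              × (∀ p → IsGeodesic N s t p → p ∈ ps)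
              × length ps ≡ k

σ₀ : ℕ → ℕ
σ₀ m = length (filter (λ d → d ∣? m) (map suc (upTo m)))

-- floor division, with the (never used here) convention a / 0 = 0
_div_ : ℕ → ℕ → ℕ
a div zero    = 0
a div (suc b) = a / suc b

{-# OPTIONS --safe #-}
-- Since s and t are not adjacent but 1 is adjacent to both, every geodesic has the form s, m, t
-- with m a common neighbour, so geodesics correspond to common neighbours. Because neither of
-- s, t divides the other, m divides both or is a multiple of both: the common neighbours are the
-- σ₀(gcd s t) divisors of gcd s t together with the ⌊N / lcm s t⌋ multiples of lcm s t in X_N,
-- and lcm s t = st / gcd s t.
module Submission where

open import Defs
open import Data.Nat using (ℕ; zero; suc; _+_; _*_; _≤_; z≤n; s≤s; NonZero; >-nonZero; ≢-nonZero; ≢-nonZero⁻¹)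
open import Data.Nat.Properties using (≤-trans; ≤-antisym; ≤-reflexive; *-comm; *-monoˡ-≤; *-cancelʳ-≡; suc-injective; m*n≢0; m*n≢0⇒n≢0)
open import Data.Nat.DivMod using (m*n/n≡m; m/n*n≤m; /-monoˡ-≤)
open import Data.Nat.Divisibility using (_∣_; _∣?_; divides; ∣-trans; ∣⇒≤; 0∣⇒≡0; 1∣_)
open import Data.Nat.GCD using (gcd; gcd[m,n]∣m; gcd[m,n]∣n; gcd-greatest; gcd[m,n]≢0)
open import Data.Nat.LCM using (lcm; m∣lcm[m,n]; n∣lcm[m,n]; lcm-least; gcd*lcm)
open import Data.List using (List; []; _∷_; length; filter; upTo; map; _++_)
open import Data.List.Properties using (length-map; length-++; length-upTo)
open import Data.List.Relation.Unary.All using ([]; _∷_)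
open import Data.List.Relation.Unary.AllPairs using ([]; _∷_)
open import Data.List.Relation.Unary.Unique.Propositional using (Unique)
import Data.List.Relation.Unary.Unique.Propositional.Properties as Unique
open import Data.List.Membership.Propositional using (_∈_)
open import Data.List.Membership.Propositional.Properties
  using (∈-filter⁺; ∈-filter⁻; ∈-map⁺; ∈-map⁻; ∈-upTo⁺; ∈-upTo⁻; ∈-++⁺ˡ; ∈-++⁺ʳ; ∈-++⁻)
open import Data.Product using (_×_; _,_; proj₁; proj₂; ∃-syntax)
open import Data.Sum using (_⊎_; inj₁; inj₂)
open import Function using (_∘_)
open import Relation.Binary.PropositionalEquality using (_≡_; _≢_; refl; sym; trans; cong; subst; module ≡-Reasoning)
open import Relation.Nullary using (¬_; contradiction)

∣⇒InX : ∀ {N d n} → d ∣ n → InX N n → InX N d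
∣⇒InX {d = zero} d∣n (1≤n , _) with 0∣⇒≡0 d∣n | 1≤n
... | refl | ()
∣⇒InX {d = suc _} d∣n (1≤n , n≤N) = s≤s z≤n , ≤-trans (∣⇒≤ {{>-nonZero 1≤n}} d∣n) n≤N

[m*n]div-m≡n : ∀ m n .{{_ : NonZero m}} → (m * n) div m ≡ n
[m*n]div-m≡n (suc m) n rewrite *-comm (suc m) n = m*n/n≡m n (suc m)

gcd-nonZero : ∀ m n .{{_ : NonZero m}} → NonZero (gcd m n)
gcd-nonZero m n = ≢-nonZero (gcd[m,n]≢0 m n (inj₁ (≢-nonZero⁻¹ m)))

lcm-nonZero : ∀ m n .{{_ : NonZero m}} .{{_ : NonZero n}} → NonZero (lcm m n)
lcm-nonZero m n = m*n≢0⇒n≢0 (gcd m n) {{subst NonZero (sym (gcd*lcm m n)) (m*n≢0 m n)}}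

[m*n]div-gcd≡lcm : ∀ m n .{{_ : NonZero m}} → (m * n) div gcd m n ≡ lcm m n
[m*n]div-gcd≡lcm m n = begin
  (m * n) div gcd m n              ≡⟨ cong (_div gcd m n) (sym (gcd*lcm m n)) ⟩
  (gcd m n * lcm m n) div gcd m n  ≡⟨ [m*n]div-m≡n (gcd m n) (lcm m n) {{gcd-nonZero m n}} ⟩
  lcm m n                          ∎
  where open ≡-Reasoning

divisors : ℕ → List ℕ
divisors n = filter (_∣? n) (map suc (upTo n))

∈-divisors⁺ : ∀ {d n} .{{_ : NonZero n}} → d ∣ n → d ∈ divisors n
∈-divisors⁺ {zero}  {n} d∣n = contradiction (0∣⇒≡0 d∣n) (≢-nonZero⁻¹ n)
∈-divisors⁺ {suc _} {n} d∣n = ∈-filter⁺ (_∣? n) (∈-map⁺ suc (∈-upTo⁺ (∣⇒≤ d∣n))) d∣n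

∈-divisors⁻ : ∀ {d n} → d ∈ divisors n → d ∣ n
∈-divisors⁻ {n = n} = proj₂ ∘ ∈-filter⁻ (_∣? n) {xs = map suc (upTo n)}

divisors-unique : ∀ n → Unique (divisors n)
divisors-unique n = Unique.filter⁺ (_∣? n) (Unique.map⁺ suc-injective (Unique.upTo⁺ n))

multiples : ℕ → ℕ → List ℕ
multiples N l = map (λ k → suc k * l) (upTo (N div l))

length-multiples : ∀ N l → length (multiples N l) ≡ N div l
length-multiples N l = trans (length-map _ (upTo (N div l))) (length-upTo (N div l))

∈-multiples⁺ : ∀ {N l m} .{{_ : NonZero l}} → l ∣ m → InX N m → m ∈ multiples N l
∈-multiples⁺ {l = suc _} (divides zero refl) (() , _)
∈-multiples⁺ {N} {l@(suc _)} (divides (suc k) refl) (_ , m≤N) =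
  ∈-map⁺ _ (∈-upTo⁺ (≤-trans (≤-reflexive (sym (m*n/n≡m (suc k) l))) (/-monoˡ-≤ l m≤N)))

∈-multiples⁻ : ∀ {N l m} → m ∈ multiples N l → l ∣ m × InX N m
∈-multiples⁻ {l = zero} ()
∈-multiples⁻ {N} {l@(suc _)} m∈ with k , k∈ , refl ← ∈-map⁻ _ m∈ =
  divides (suc k) refl , s≤s z≤n , ≤-trans (*-monoˡ-≤ l (∈-upTo⁻ k∈)) (m/n*n≤m N l)

multiples-unique : ∀ N l .{{_ : NonZero l}} → Unique (multiples N l)
multiples-unique N l =
  Unique.map⁺ (suc-injective ∘ *-cancelʳ-≡ _ _ l) (Unique.upTo⁺ (N div l))

CommonNeighbour : ℕ → ℕ → ℕ → ℕ → Set
CommonNeighbour N s t m = InX N m × Adj s m × Adj m t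

path₂ : ℕ → ℕ → ℕ → List ℕ
path₂ s m t = s ∷ m ∷ t ∷ []

path₂-injective : ∀ {s t m m′} → path₂ s m t ≡ path₂ s m′ t → m ≡ m′
path₂-injective refl = refl

path₂-isPath : ∀ {N s t m} → InX N s → InX N t → s ≢ t →
               CommonNeighbour N s t m → IsPath N s t (path₂ s m t)
path₂-isPath s∈X t∈X s≢t (m∈X , s~m@(s≢m , _) , m~t@(m≢t , _)) = record
  { vertices = s∈X ∷ m∈X ∷ t∈X ∷ []
  ; adjacent = s~m ∷ m~t ∷ [-]
  ; simple   = (s≢m ∷ s≢t ∷ []) ∷ (m≢t ∷ []) ∷ [] ∷ []
  ; starts   = _ , refl
  ; ends     = refl
  }

nonAdjacent⇒2≤pathLength : ∀ {N s t} → s ≢ t → ¬ Adj s t →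
                           ∀ q → IsPath N s t q → 2 ≤ pathLength q
nonAdjacent⇒2≤pathLength _ _ [] record { starts = _ , () }
nonAdjacent⇒2≤pathLength s≢t _ (_ ∷ []) record { starts = _ , refl ; ends = refl } =
  contradiction refl s≢t
nonAdjacent⇒2≤pathLength _ ¬s~t (_ ∷ _ ∷ []) record { adjacent = s~t ∷ [-] ; starts = _ , refl ; ends = refl } =
  contradiction s~t ¬s~t
nonAdjacent⇒2≤pathLength _ _ (_ ∷ _ ∷ _ ∷ _) _ = s≤s (s≤s z≤n)

pathLength≡2⇒path₂ : ∀ {N s t} q → IsPath N s t q → pathLength q ≡ 2 →
                     ∃[ m ] q ≡ path₂ s m t × CommonNeighbour N s t m
pathLength≡2⇒path₂ (_ ∷ m ∷ _ ∷ [])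
  record { vertices = _ ∷ m∈X ∷ _ ; adjacent = s~m ∷ m~t ∷ [-] ; starts = _ , refl ; ends = refl } refl =
  m , refl , m∈X , s~m , m~t
pathLength≡2⇒path₂ [] _ ()
pathLength≡2⇒path₂ (_ ∷ []) _ ()
pathLength≡2⇒path₂ (_ ∷ _ ∷ []) _ ()
pathLength≡2⇒path₂ (_ ∷ _ ∷ _ ∷ _ ∷ _) _ ()

module Geodesics {N s t : ℕ} (s∈X : InX N s) (t∈X : InX N t) (s≢t : s ≢ t) (¬s~t : ¬ Adj s t) where

  path₂-isGeodesic : ∀ {m} → CommonNeighbour N s t m → IsGeodesic N s t (path₂ s m t)
  path₂-isGeodesic m∼ = path₂-isPath s∈X t∈X s≢t m∼ , nonAdjacent⇒2≤pathLength s≢t ¬s~t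

  isGeodesic⇒path₂ : ∀ {c q} → CommonNeighbour N s t c → IsGeodesic N s t q →
                     ∃[ m ] q ≡ path₂ s m t × CommonNeighbour N s t m
  isGeodesic⇒path₂ {c} {q} c∼ (q-path , q-min) = pathLength≡2⇒path₂ q q-path
    (≤-antisym (q-min (path₂ s c t) (path₂-isPath s∈X t∈X s≢t c∼))
               (nonAdjacent⇒2≤pathLength s≢t ¬s~t q q-path))

  numGeodesics-commonNeighbours :
    ∀ {c} → CommonNeighbour N s t c →
    (ms : List ℕ) → Unique ms →
    (∀ {m} → m ∈ ms → CommonNeighbour N s t m) →
    (∀ {m} → CommonNeighbour N s t m → m ∈ ms) →
    NumGeodesics N s t (length ms)
  numGeodesics-commonNeighbours c∼ ms ms-unique sound complete =
      map (λ m → path₂ s m t) ms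
    , Unique.map⁺ path₂-injective ms-unique
    , geodesic
    , enumerated
    , length-map _ ms
    where
    geodesic : ∀ p → p ∈ map (λ m → path₂ s m t) ms → IsGeodesic N s t p
    geodesic p p∈ with m , m∈ , refl ← ∈-map⁻ _ p∈ = path₂-isGeodesic (sound m∈)

    enumerated : ∀ p → IsGeodesic N s t p → p ∈ map (λ m → path₂ s m t) ms
    enumerated p p-geo with m , refl , m∼ ← isGeodesic⇒path₂ c∼ p-geo = ∈-map⁺ _ (complete m∼)

module Incomparable {s t : ℕ} (s∤t : ¬ s ∣ t) (t∤s : ¬ t ∣ s) where

  commonDivisor⇒adj : ∀ {m} → m ∣ s → m ∣ t → Adj s m × Adj m t
  commonDivisor⇒adj m∣s m∣t =
    ((λ { refl → s∤t m∣t }) , inj₂ m∣s) , ((λ { refl → t∤s m∣s }) , inj₁ m∣t)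

  commonMultiple⇒adj : ∀ {m} → s ∣ m → t ∣ m → Adj s m × Adj m t
  commonMultiple⇒adj s∣m t∣m =
    ((λ { refl → t∤s t∣m }) , inj₁ s∣m) , ((λ { refl → s∤t s∣m }) , inj₂ t∣m)

  adj⇒commonDivisor⊎commonMultiple : ∀ {m} → Adj s m → Adj m t → (m ∣ s × m ∣ t) ⊎ (s ∣ m × t ∣ m)
  adj⇒commonDivisor⊎commonMultiple (_ , inj₁ s∣m) (_ , inj₁ m∣t) = contradiction (∣-trans s∣m m∣t) s∤t
  adj⇒commonDivisor⊎commonMultiple (_ , inj₁ s∣m) (_ , inj₂ t∣m) = inj₂ (s∣m , t∣m)
  adj⇒commonDivisor⊎commonMultiple (_ , inj₂ m∣s) (_ , inj₁ m∣t) = inj₁ (m∣s , m∣t)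
  adj⇒commonDivisor⊎commonMultiple (_ , inj₂ m∣s) (_ , inj₂ t∣m) = contradiction (∣-trans t∣m m∣s) t∤s

commonNeighbours : ℕ → ℕ → ℕ → List ℕ
commonNeighbours N s t = divisors (gcd s t) ++ multiples N (lcm s t)

length-commonNeighbours : ∀ N s t → length (commonNeighbours N s t) ≡ σ₀ (gcd s t) + N div lcm s t
length-commonNeighbours N s t = begin
  length (divisors (gcd s t) ++ multiples N (lcm s t))
    ≡⟨ length-++ (divisors (gcd s t)) ⟩
  σ₀ (gcd s t) + length (multiples N (lcm s t))
    ≡⟨ cong (σ₀ (gcd s t) +_) (length-multiples N (lcm s t)) ⟩
  σ₀ (gcd s t) + N div lcm s t
    ∎
  where open ≡-Reasoning

module IncomparableVertices {N s t : ℕ} (s∈X : InX N s) (t∈X : InX N t) (s∤t : ¬ s ∣ t) (t∤s : ¬ t ∣ s) where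

  private instance
    s-nonZero : NonZero s
    s-nonZero = >-nonZero (proj₁ s∈X)
    t-nonZero : NonZero t
    t-nonZero = >-nonZero (proj₁ t∈X)
    gcd[s,t]-nonZero : NonZero (gcd s t)
    gcd[s,t]-nonZero = gcd-nonZero s t
    lcm[s,t]-nonZero : NonZero (lcm s t)
    lcm[s,t]-nonZero = lcm-nonZero s t

  open Incomparable s∤t t∤s

  1-commonNeighbour : CommonNeighbour N s t 1
  1-commonNeighbour = ∣⇒InX (1∣ s) s∈X , commonDivisor⇒adj (1∣ s) (1∣ t)

  ∈-commonNeighbours⁻ : ∀ {m} → m ∈ commonNeighbours N s t → CommonNeighbour N s t m
  ∈-commonNeighbours⁻ m∈ with ∈-++⁻ (divisors (gcd s t)) m∈
  ... | inj₁ m∈divisors =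
    let m∣s = ∣-trans (∈-divisors⁻ m∈divisors) (gcd[m,n]∣m s t)
        m∣t = ∣-trans (∈-divisors⁻ m∈divisors) (gcd[m,n]∣n s t)
    in ∣⇒InX m∣s s∈X , commonDivisor⇒adj m∣s m∣t
  ... | inj₂ m∈multiples with lcm∣m , m∈X ← ∈-multiples⁻ m∈multiples =
    m∈X , commonMultiple⇒adj (∣-trans (m∣lcm[m,n] s t) lcm∣m) (∣-trans (n∣lcm[m,n] s t) lcm∣m)

  ∈-commonNeighbours⁺ : ∀ {m} → CommonNeighbour N s t m → m ∈ commonNeighbours N s t
  ∈-commonNeighbours⁺ (m∈X , s~m , m~t) with adj⇒commonDivisor⊎commonMultiple s~m m~t
  ... | inj₁ (m∣s , m∣t) = ∈-++⁺ˡ (∈-divisors⁺ (gcd-greatest m∣s m∣t))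
  ... | inj₂ (s∣m , t∣m) = ∈-++⁺ʳ (divisors (gcd s t)) (∈-multiples⁺ (lcm-least s∣m t∣m) m∈X)

  commonNeighbours-unique : Unique (commonNeighbours N s t)
  commonNeighbours-unique =
    Unique.++⁺ (divisors-unique (gcd s t)) (multiples-unique N (lcm s t)) divisor-and-multiple
    where
    divisor-and-multiple : ∀ {m} → ¬ (m ∈ divisors (gcd s t) × m ∈ multiples N (lcm s t))
    divisor-and-multiple (m∈divisors , m∈multiples) =
      s∤t (∣-trans (∣-trans (m∣lcm[m,n] s t) (proj₁ (∈-multiples⁻ m∈multiples)))
                   (∣-trans (∈-divisors⁻ m∈divisors) (gcd[m,n]∣n s t)))

theorem4 : (N s t : ℕ) → 1 ≤ N → InX N s → InX N t → s ≢ t → ¬ Adj s t →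
    NumGeodesics N s t (σ₀ (gcd s t) + N div ((s * t) div (gcd s t)))
theorem4 N s t _ s∈X t∈X s≢t ¬s~t =
  subst (NumGeodesics N s t) count
    (numGeodesics-commonNeighbours 1-commonNeighbour (commonNeighbours N s t)
      commonNeighbours-unique ∈-commonNeighbours⁻ ∈-commonNeighbours⁺)
  where
  s∤t : ¬ s ∣ t
  s∤t s∣t = ¬s~t (s≢t , inj₁ s∣t)

  t∤s : ¬ t ∣ s
  t∤s t∣s = ¬s~t (s≢t , inj₂ t∣s)

  open Geodesics s∈X t∈X s≢t ¬s~t
  open IncomparableVertices s∈X t∈X s∤t t∤s

  count : length (commonNeighbours N s t) ≡ σ₀ (gcd s t) + N div ((s * t) div gcd s t)
  count = trans (length-commonNeighbours N s t)
    (cong (λ l → σ₀ (gcd s t) + N div l) (sym ([m*n]div-gcd≡lcm s t {{>-nonZero (proj₁ s∈X)}})))
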